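{- For all $n\geq 1$, the number of desarrangements of length $n$ avoiding both $132$ and $321$ is $d_n(132,321)=n-1$.
   Context: Permutations are in one-line notation. An index $i\in[n-1]$ is a descent of $\pi\in\mathfrak{S}_n$ if $\pi_i>\pi_{i+1}$; $i\in[n]$ is an ascent if it is not a descent (so $n$ is always an ascent). A desarrangement is a permutation whose first ascent is even. $d_n(\Pi)$ is the number of desarrangements in $\mathfrak{S}_n$ avoiding every pattern in $\Pi$ ($\pi$ avoids $\sigma$ if no subsequence of $\pi$ has the same relative order as $\sigma$). -}

module Defs where

open import Data.Nat using (ℕ; zero; suc; _<_; _<ᵇ_; _≡ᵇ_)
open import Data.Bool using (Bool; true; false; _∧_; _∨_; not; if_then_else_)
open import Data.List using (List; []; _∷_; length; filterᵇ; map; concatMap; allFin; _++_)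
open import Data.Bool.ListAction using (all; any; and)
open import Data.Fin using (Fin; toℕ)
open import Data.Vec using (Vec; toList)

words : ℕ → ℕ → List (List ℕ)
words m zero = [] ∷ []
words m (suc n) = concatMap (λ w → map (λ (a : Fin m) → toℕ a ∷ w) (allFin m)) (words m n)

distinct : List ℕ → Bool
distinct [] = true
distinct (x ∷ xs) = all (λ y → not (x ≡ᵇ y)) xs ∧ distinct xs

-- The permutations of length n (one-line notation over values 0,…,n-1;
-- the shift from values 1..n is order-preserving, hence irrelevant).
perms : ℕ → List (List ℕ)
perms n = filterᵇ distinct (words n n)

subseqs : List ℕ → List (List ℕ)
subseqs [] = [] ∷ []
subseqs (x ∷ xs) = map (x ∷_) (subseqs xs) ++ subseqs xs

sameOrder : List ℕ → List ℕ → Bool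
sameOrder [] [] = true
sameOrder (x ∷ xs) (y ∷ ys) =
  and (zipPairs xs ys) ∧ sameOrder xs ys
  where
  zipPairs : List ℕ → List ℕ → List Bool
  zipPairs (a ∷ as) (b ∷ bs) = ((x <ᵇ a) ≡ᵇB (y <ᵇ b)) ∷ ((a <ᵇ x) ≡ᵇB (b <ᵇ y)) ∷ zipPairs as bs
    where
    _≡ᵇB_ : Bool → Bool → Bool
    true ≡ᵇB true = true
    false ≡ᵇB false = true
    _ ≡ᵇB _ = false
  zipPairs _ _ = []
sameOrder _ _ = false

contains : List ℕ → List ℕ → Bool
contains π σ = any (sameOrder σ) (subseqs π)

avoids : List ℕ → List ℕ → Bool
avoids π σ = not (contains π σ)

-- first ascent: least i ≥ 1 such that i = n or π_i < π_{i+1}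
-- (i is an ascent iff it is not a descent; n is always an ascent)
firstAscentFrom : ℕ → List ℕ → ℕ
firstAscentFrom i [] = i
firstAscentFrom i (x ∷ []) = i
firstAscentFrom i (x ∷ y ∷ ys) =
  if y <ᵇ x then firstAscentFrom (suc i) (y ∷ ys) else i

firstAscent : List ℕ → ℕ
firstAscent = firstAscentFrom 1

even : ℕ → Bool
even zero = true
even (suc zero) = false
even (suc (suc n)) = even n

desarrangement : List ℕ → Bool
desarrangement π = even (firstAscent π)

d : ℕ → List (List ℕ) → ℕ
d n Π = length (filterᵇ (λ π → desarrangement π ∧ all (avoids π) Π) (perms n))

module Submission where

-- A desarrangement π starts with a descent a > b. Avoiding 321 makes b smaller than every later
-- entry, and then avoiding 132 makes everything after b increase; so π is a followed by the other
-- values in increasing order, with a ≠ 0. Conversely, for each of the n - 1 values a ≠ 0 this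
-- permutation has its first ascent at position 2 and contains neither pattern, since an occurrence
-- of either would need a descent inside the increasing tail.

open import Defs
open import Data.Nat using (ℕ; zero; suc; _≥_; _∸_; _+_; _<_; _≤_; _<ᵇ_; _≡ᵇ_; z≤n; s≤s; _≟_)
open import Data.Nat.Properties
open import Data.Bool using (Bool; true; false; _∧_; not; T)
open import Data.Bool.Properties using (T-∧; T-≡; T?)
open import Data.Bool.ListAction using (all)
open import Data.Unit using (tt)
open import Data.Empty using (⊥-elim)
open import Data.Fin using (Fin; toℕ; fromℕ<)
open import Data.Fin.Properties using (toℕ<n; toℕ-fromℕ<; toℕ-injective)
open import Data.Product using (∃; ∃₂; _×_; _,_; proj₂)
open import Data.Sum using (inj₁; inj₂)
open import Data.List using (List; []; _∷_; length; map; allFin; filterᵇ)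
open import Data.List.Properties using (∷-injectiveˡ; ∷-injectiveʳ; length-map)
open import Data.List.Membership.Propositional using (_∈_; _∉_; find; lose)
open import Data.List.Membership.Propositional.Properties
open import Data.List.Membership.Propositional.Properties.WithK using (unique∧set⇒bag)
open import Data.List.Relation.Unary.Any using (here; there)
open import Data.List.Relation.Unary.Any.Properties using (any⁺; any⁻)
open import Data.List.Relation.Unary.All as All using (All; []; _∷_)
open import Data.List.Relation.Unary.All.Properties as All using (all⁺; all⁻)
open import Data.List.Relation.Unary.AllPairs as AllPairs using (AllPairs; []; _∷_)
import Data.List.Relation.Unary.AllPairs.Properties as AllPairs
open import Data.List.Relation.Unary.Unique.Propositional using (Unique)
import Data.List.Relation.Unary.Unique.Propositional.Properties as Unique
open import Data.List.Relation.Binary.Sublist.Propositional using (_⊆_; []; _∷_; _∷ʳ_; from∈; ⊆-refl)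
open import Data.List.Relation.Binary.Sublist.Propositional.Properties using (All-resp-⊆; ∷⁻)
open import Data.List.Relation.Binary.BagAndSetEquality using (∼bag⇒↭)
open import Data.List.Relation.Binary.Permutation.Propositional using (_↭_)
open import Data.List.Relation.Binary.Permutation.Propositional.Properties using (↭-length)
open import Function using (_∘_; _⇔_; mk⇔; Equivalence)
open import Relation.Nullary using (¬_; yes; no; contradiction)
open import Relation.Binary.PropositionalEquality

open Equivalence using (to; from)

<ᵇ-true : ∀ {m n} → m < n → (m <ᵇ n) ≡ true
<ᵇ-true = to T-≡ ∘ <⇒<ᵇ

<ᵇ-false : ∀ {m n} → n ≤ m → (m <ᵇ n) ≡ false
<ᵇ-false {m} {n} n≤m with m <ᵇ n in eq
... | false = refl
... | true  = contradiction (<ᵇ⇒< m n (from T-≡ eq)) (≤⇒≯ n≤m)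

T-not : ∀ {b} → T (not b) ⇔ (¬ T b)
T-not {true}  = mk⇔ (λ ()) (λ ¬t → ¬t tt)
T-not {false} = mk⇔ (λ _ ()) _

T-not-≡ᵇ : ∀ m n → T (not (m ≡ᵇ n)) ⇔ m ≢ n
T-not-≡ᵇ m n = mk⇔ (λ t → to T-not t ∘ ≡⇒≡ᵇ m n) (λ m≢n → from T-not (m≢n ∘ ≡ᵇ⇒≡ m n))

T-distinct⇔Unique : ∀ xs → T (distinct xs) ⇔ Unique xs
T-distinct⇔Unique [] = mk⇔ (λ _ → []) _
T-distinct⇔Unique (x ∷ xs) = mk⇔
  (λ t → let (fresh , rest) = to T-∧ t in
    All.map (to (T-not-≡ᵇ x _)) (all⁺ _ xs fresh) ∷ to (T-distinct⇔Unique xs) rest)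
  (λ { (fresh ∷ rest) →
    from T-∧ (all⁻ _ (All.map (from (T-not-≡ᵇ x _)) fresh) , from (T-distinct⇔Unique xs) rest) })

extensions : ∀ m → List ℕ → List (List ℕ)
extensions m w = map (λ (a : Fin m) → toℕ a ∷ w) (allFin m)

∈-words⁻ : ∀ m n {w} → w ∈ words m n → length w ≡ n × All (_< m) w
∈-words⁻ m zero (here refl) = refl , []
∈-words⁻ m (suc n) w∈ with find (∈-concatMap⁻ (extensions m) {words m n} w∈)
... | w′ , w′∈ , w∈ext with ∈-map⁻ _ w∈ext
... | a , _ , refl = let (len , bounded) = ∈-words⁻ m n w′∈ in cong suc len , toℕ<n a ∷ bounded

∈-words⁺ : ∀ m n {w} → length w ≡ n → All (_< m) w → w ∈ words m n
∈-words⁺ m zero {[]} _ _ = here refl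
∈-words⁺ m (suc n) {x ∷ w} len (x<m ∷ bounded) =
  ∈-concatMap⁺ (extensions m) {words m n} (lose (∈-words⁺ m n (suc-injective len) bounded) x∷w∈ext)
  where
  x∷w∈ext : x ∷ w ∈ extensions m w
  x∷w∈ext = subst (λ y → y ∷ w ∈ extensions m w) (toℕ-fromℕ< x<m)
                  (∈-map⁺ _ (∈-allFin (fromℕ< x<m)))

words-unique : ∀ m n → Unique (words m n)
words-unique m zero = [] ∷ []
words-unique m (suc n) =
  Unique.concat⁺ (All.map⁺ (All.universal extensions-unique (words m n)))
                 (AllPairs.map⁺ (AllPairs.map extensions-disjoint (words-unique m n)))
  where
  extensions-unique : ∀ w → Unique (extensions m w)
  extensions-unique w = Unique.map⁺ (toℕ-injective ∘ ∷-injectiveˡ) (Unique.allFin⁺ m)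
  extensions-disjoint : ∀ {w w′} → w ≢ w′ → ∀ {v} → ¬ (v ∈ extensions m w × v ∈ extensions m w′)
  extensions-disjoint w≢w′ (p , q) with ∈-map⁻ _ p | ∈-map⁻ _ q
  ... | _ , _ , refl | _ , _ , v≡ = w≢w′ (∷-injectiveʳ v≡)

IsPermutation : ℕ → List ℕ → Set
IsPermutation n w = length w ≡ n × All (_< n) w × Unique w

∈-perms⁻ : ∀ n {w} → w ∈ perms n → IsPermutation n w
∈-perms⁻ n w∈ with ∈-filter⁻ (T? ∘ distinct) {xs = words n n} w∈
... | w∈words , t = let (len , bounded) = ∈-words⁻ n n w∈words in len , bounded , to (T-distinct⇔Unique _) t

∈-perms⁺ : ∀ n {w} → IsPermutation n w → w ∈ perms n
∈-perms⁺ n (len , bounded , unique) =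
  ∈-filter⁺ (T? ∘ distinct) (∈-words⁺ n n len bounded) (from (T-distinct⇔Unique _) unique)

⊆⇒∈-subseqs : ∀ {s π} → s ⊆ π → s ∈ subseqs π
⊆⇒∈-subseqs [] = here refl
⊆⇒∈-subseqs {π = y ∷ π} (_ ∷ʳ τ) = ∈-++⁺ʳ (map (y ∷_) (subseqs π)) (⊆⇒∈-subseqs τ)
⊆⇒∈-subseqs (refl ∷ τ) = ∈-++⁺ˡ (∈-map⁺ _ (⊆⇒∈-subseqs τ))

∈-subseqs⇒⊆ : ∀ π {s} → s ∈ subseqs π → s ⊆ π
∈-subseqs⇒⊆ [] (here refl) = []
∈-subseqs⇒⊆ (y ∷ π) s∈ with ∈-++⁻ (map (y ∷_) (subseqs π)) s∈
... | inj₂ s∈skip = y ∷ʳ ∈-subseqs⇒⊆ π s∈skip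
... | inj₁ s∈keep with ∈-map⁻ _ s∈keep
...   | s′ , s′∈ , refl = refl ∷ ∈-subseqs⇒⊆ π s′∈

contains⁺ : ∀ {π σ s} → s ⊆ π → T (sameOrder σ s) → T (contains π σ)
contains⁺ τ t = any⁺ _ (lose (⊆⇒∈-subseqs τ) t)

contains⁻ : ∀ π σ → T (contains π σ) → ∃ λ s → s ⊆ π × T (sameOrder σ s)
contains⁻ π σ t with find (any⁻ _ (subseqs π) t)
... | s , s∈ , so = s , ∈-subseqs⇒⊆ π s∈ , so

AllPairs-resp-⊆ : ∀ {A : Set} {R : A → A → Set} {xs ys} → ys ⊆ xs → AllPairs R xs → AllPairs R ys
AllPairs-resp-⊆ [] [] = []
AllPairs-resp-⊆ (_ ∷ʳ τ) (_ ∷ ps) = AllPairs-resp-⊆ τ ps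
AllPairs-resp-⊆ (refl ∷ τ) (p ∷ ps) = All-resp-⊆ τ p ∷ AllPairs-resp-⊆ τ ps

AllPairs-pair : ∀ {A : Set} {R : A → A → Set} {xs y z} → AllPairs R xs → y ∷ z ∷ [] ⊆ xs → R y z
AllPairs-pair ps τ with AllPairs-resp-⊆ τ ps
... | (r ∷ []) ∷ _ = r

AllPairs-from-pairs : ∀ {A : Set} {R : A → A → Set} xs →
                      (∀ {y z} → y ∷ z ∷ [] ⊆ xs → R y z) → AllPairs R xs
AllPairs-from-pairs [] _ = []
AllPairs-from-pairs (x ∷ xs) r =
  All.tabulate (λ z∈ → r (refl ∷ from∈ z∈)) ∷ AllPairs-from-pairs xs (r ∘ (x ∷ʳ_))

sameOrder-tail : ∀ {p σ x s} → T (sameOrder (p ∷ σ) (x ∷ s)) → T (sameOrder σ s)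
sameOrder-tail = proj₂ ∘ to T-∧

sameOrder-descent : ∀ {q r σ y z s} → r < q → T (sameOrder (q ∷ r ∷ σ) (y ∷ z ∷ s)) → z < y
sameOrder-descent {y = y} {z} r<q t
  rewrite <ᵇ-true r<q | <ᵇ-false (<⇒≤ r<q) with y <ᵇ z | z <ᵇ y in z<ᵇy
... | _     | true  = <ᵇ⇒< z y (from T-≡ z<ᵇy)
... | true  | false = ⊥-elim t
... | false | false = ⊥-elim t

∷-increasing⇒avoids : ∀ {a v p q r σ} → AllPairs _<_ v → r < q → T (avoids (a ∷ v) (p ∷ q ∷ r ∷ σ))
∷-increasing⇒avoids {a} {v} {p} {q} {r} {σ} increasing r<q =
  from T-not λ c → let (s , τ , t) = contains⁻ (a ∷ v) (p ∷ q ∷ r ∷ σ) c in no-occurrence s τ t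
  where
  no-occurrence : ∀ s → s ⊆ a ∷ v → ¬ T (sameOrder (p ∷ q ∷ r ∷ σ) s)
  no-occurrence (x ∷ y ∷ []) _ t =
    sameOrder-tail {q} {r ∷ σ} {y} {[]} (sameOrder-tail {p} {q ∷ r ∷ σ} {x} {y ∷ []} t)
  no-occurrence (x ∷ y ∷ z ∷ s) τ t with AllPairs-resp-⊆ (∷⁻ τ) increasing
  ... | (y<z ∷ _) ∷ _ =
    <-asym y<z (sameOrder-descent {σ = σ} {s = s} r<q (sameOrder-tail {p} {q ∷ r ∷ σ} {x} t))

sameOrder-321 : ∀ {x y z} → z < y → y < x → T (sameOrder (3 ∷ 2 ∷ 1 ∷ []) (x ∷ y ∷ z ∷ []))
sameOrder-321 z<y y<x
  rewrite <ᵇ-true z<y | <ᵇ-true y<x | <ᵇ-true (<-trans z<y y<x)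
        | <ᵇ-false (<⇒≤ z<y) | <ᵇ-false (<⇒≤ y<x) | <ᵇ-false (<⇒≤ (<-trans z<y y<x)) = tt

sameOrder-132 : ∀ {x y z} → x < z → z < y → T (sameOrder (1 ∷ 3 ∷ 2 ∷ []) (x ∷ y ∷ z ∷ []))
sameOrder-132 x<z z<y
  rewrite <ᵇ-true x<z | <ᵇ-true z<y | <ᵇ-true (<-trans x<z z<y)
        | <ᵇ-false (<⇒≤ x<z) | <ᵇ-false (<⇒≤ z<y) | <ᵇ-false (<⇒≤ (<-trans x<z z<y)) = tt

desarrangement⇒descent : ∀ π → T (desarrangement π) → ∃₂ λ a b → ∃ λ r → π ≡ a ∷ b ∷ r × b < a
-- The omitted lists (length < 2, or an initial ascent) have first ascent 1.
desarrangement⇒descent (a ∷ b ∷ r) t with b <ᵇ a in b<ᵇa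
... | true = a , b , r , refl , <ᵇ⇒< b a (from T-≡ b<ᵇa)

desarrangement-∷0 : ∀ {a} r → 0 < a → T (desarrangement (a ∷ 0 ∷ r))
desarrangement-∷0 {suc _} []      _ = tt
desarrangement-∷0 {suc _} (_ ∷ _) _ = tt

range : ℕ → ℕ → List ℕ
range lo zero    = []
range lo (suc k) = lo ∷ range (suc lo) k

length-range : ∀ lo k → length (range lo k) ≡ k
length-range lo zero    = refl
length-range lo (suc k) = cong suc (length-range (suc lo) k)

range-lower : ∀ lo k → All (lo ≤_) (range lo k)
range-lower lo zero    = []
range-lower lo (suc k) = ≤-refl ∷ All.map (≤-trans (n≤1+n lo)) (range-lower (suc lo) k)

range-upper : ∀ lo k → All (_< lo + k) (range lo k)
range-upper lo zero    = []
range-upper lo (suc k) rewrite +-suc lo k = s≤s (m≤m+n lo k) ∷ range-upper (suc lo) k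

range-increasing : ∀ lo k → AllPairs _<_ (range lo k)
range-increasing lo zero    = []
range-increasing lo (suc k) = range-lower (suc lo) k ∷ range-increasing (suc lo) k

∈-range : ∀ lo k {a} → lo ≤ a → a < lo + k → a ∈ range lo k
∈-range lo zero    lo≤a a<lo+0 = contradiction (≤-trans a<lo+0 (≤-reflexive (+-identityʳ lo))) (≤⇒≯ lo≤a)
∈-range lo (suc k) {a} lo≤a a<hi with m≤n⇒m<n∨m≡n lo≤a
... | inj₂ refl = here refl
... | inj₁ lo<a = there (∈-range (suc lo) k lo<a (subst (a <_) (+-suc lo k) a<hi))

All-<-+-suc : ∀ lo k {s} → All (_< lo + suc k) s → All (_< suc lo + k) s
All-<-+-suc lo k = All.map (λ {y} → subst (y <_) (+-suc lo k))

increasing⇒length+head≤bound : ∀ {x s hi} → AllPairs _<_ (x ∷ s) → All (_< hi) (x ∷ s) →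
                               length (x ∷ s) + x ≤ hi
increasing⇒length+head≤bound {s = []} _ (x<hi ∷ []) = x<hi
increasing⇒length+head≤bound {x} {y ∷ s} ((x<y ∷ _) ∷ increasing) (_ ∷ bounded) = begin
  suc (suc (length s + x)) ≡⟨ cong suc (+-suc (length s) x) ⟨
  suc (length s + suc x)   ≤⟨ s≤s (+-monoʳ-≤ (length s) x<y) ⟩
  suc (length s + y)       ≤⟨ increasing⇒length+head≤bound increasing bounded ⟩
  _                        ∎
  where open ≤-Reasoning

increasing⇒≡range : ∀ lo k {s} → AllPairs _<_ s → All (lo ≤_) s → All (_< lo + k) s → length s ≡ k →
                    s ≡ range lo k
increasing⇒≡range lo zero    {[]}    _ _ _ _ = refl
increasing⇒≡range lo (suc k) {x ∷ s} increasing@(x<s ∷ s-increasing) (lo≤x ∷ _) bounded len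
  with m≤n⇒m<n∨m≡n lo≤x
... | inj₂ refl = cong (lo ∷_) (increasing⇒≡range (suc lo) k s-increasing x<s
                    (All-<-+-suc lo k (All.tail bounded)) (suc-injective len))
... | inj₁ lo<x = contradiction
                    (subst (λ l → l + x ≤ lo + suc k) len (increasing⇒length+head≤bound increasing bounded))
                    (<⇒≱ (subst (lo + suc k <_) (+-comm x (suc k)) (+-monoˡ-< (suc k) lo<x)))

delete : ℕ → List ℕ → List ℕ
delete a []       = []
delete a (x ∷ xs) with x ≟ a
... | yes _ = xs
... | no  _ = x ∷ delete a xs

delete-⊆ : ∀ a xs → delete a xs ⊆ xs
delete-⊆ a []       = []
delete-⊆ a (x ∷ xs) with x ≟ a
... | yes _ = x ∷ʳ ⊆-refl
... | no  _ = refl ∷ delete-⊆ a xs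

length-delete : ∀ {a xs} → a ∈ xs → suc (length (delete a xs)) ≡ length xs
length-delete {a} {x ∷ xs} a∈ with x ≟ a | a∈
... | yes _   | _          = refl
... | no  x≢a | here a≡x   = contradiction (sym a≡x) x≢a
... | no  _   | there a∈xs = cong suc (length-delete a∈xs)

∉-delete : ∀ {a xs} → Unique xs → a ∉ delete a xs
∉-delete {a} {x ∷ xs} (x∉xs ∷ unique) with x ≟ a
... | yes refl = λ a∈xs → All.lookup x∉xs a∈xs refl
... | no  x≢a  = λ { (here a≡x) → x≢a (sym a≡x) ; (there a∈rest) → ∉-delete unique a∈rest }

increasing-above⇒≡delete-range : ∀ lo k {s a} → AllPairs _<_ s → All (suc lo ≤_) s → All (_< lo + suc k) s →
                                 length s ≡ k → a ∉ s → lo ≤ a → a < lo + suc k → s ≡ delete a (range lo (suc k))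
increasing-above⇒≡delete-range lo k {s} {a} increasing above bounded len a∉s lo≤a a<hi
  with s≡range ← increasing⇒≡range (suc lo) k increasing above (All-<-+-suc lo k bounded) len
  with lo ≟ a
... | yes refl = s≡range
... | no lo≢a  = contradiction (subst (a ∈_) (sym s≡range)
                   (∈-range (suc lo) k (≤∧≢⇒< lo≤a lo≢a) (subst (a <_) (+-suc lo k) a<hi))) a∉s

increasing⇒≡delete-range : ∀ lo k {s a} → AllPairs _<_ s → All (lo ≤_) s → All (_< lo + suc k) s →
                           length s ≡ k → a ∉ s → lo ≤ a → a < lo + suc k → s ≡ delete a (range lo (suc k))
increasing⇒≡delete-range lo k {[]} increasing _ = increasing-above⇒≡delete-range lo k increasing []
increasing⇒≡delete-range lo k {x ∷ s} {a} increasing@(x<s ∷ s-increasing) (lo≤x ∷ _)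
                         bounded len a∉s lo≤a a<hi with m≤n⇒m<n∨m≡n lo≤x
... | inj₁ lo<x = increasing-above⇒≡delete-range lo k increasing (lo<x ∷ All.map (<-trans lo<x) x<s)
                    bounded len a∉s lo≤a a<hi
... | inj₂ refl with lo ≟ a | k | len
...   | yes refl | _      | _   = contradiction (here refl) a∉s
...   | no lo≢a  | suc k′ | len′ = cong (lo ∷_) (increasing⇒≡delete-range (suc lo) k′ s-increasing x<s
                    (All-<-+-suc lo (suc k′) (All.tail bounded)) (suc-injective len′)
                    (a∉s ∘ there) (≤∧≢⇒< lo≤a lo≢a) (subst (a <_) (+-suc lo (suc k′)) a<hi))

p132 p321 : List ℕ
p132 = 1 ∷ 3 ∷ 2 ∷ []
p321 = 3 ∷ 2 ∷ 1 ∷ []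

good : List ℕ → Bool
good π = desarrangement π ∧ all (avoids π) (p132 ∷ p321 ∷ [])

moveToFront : ℕ → ℕ → List ℕ
moveToFront n a = a ∷ delete a (range 0 n)

avoids-132-321⇒increasing-tail : ∀ {a b r} → Unique (a ∷ b ∷ r) → b < a →
  ¬ T (contains (a ∷ b ∷ r) p321) → ¬ T (contains (a ∷ b ∷ r) p132) → AllPairs _<_ (b ∷ r)
avoids-132-321⇒increasing-tail {a} {b} {r} (_ ∷ b∉r ∷ r-unique) b<a no321 no132 = b<r ∷ r-increasing
  where
  b<r : All (b <_) r
  b<r = All.tabulate λ {x} x∈r →
    ≤∧≢⇒< (≮⇒≥ λ x<b → no321 (contains⁺ (refl ∷ refl ∷ from∈ x∈r) (sameOrder-321 x<b b<a)))
          (All.lookup b∉r x∈r)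
  r-increasing : AllPairs _<_ r
  r-increasing = AllPairs-from-pairs r λ τ →
    let b<z = All.lookup (All-resp-⊆ τ b<r) (there (here refl)) in
    ≤∧≢⇒< (≮⇒≥ λ z<y → no132 (contains⁺ (a ∷ʳ refl ∷ τ) (sameOrder-132 b<z z<y)))
          (AllPairs-pair r-unique τ)

good⇒moveToFront : ∀ m {w} → IsPermutation (suc m) w → T (good w) →
                   ∃ λ a → a ∈ range 1 m × w ≡ moveToFront (suc m) a
good⇒moveToFront m {w} (len , bounded , unique) t
  with des , avoidance ← to T-∧ t
  with a , b , r , refl , b<a ← desarrangement⇒descent w des
  with no132 ∷ no321 ∷ [] ← all⁺ (avoids w) (p132 ∷ p321 ∷ []) avoidance =
  a , ∈-range 1 m (≤-trans (s≤s z≤n) b<a) (All.head bounded) ,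
  cong (a ∷_) (increasing⇒≡delete-range 0 m
    (avoids-132-321⇒increasing-tail unique b<a (to T-not no321) (to T-not no132))
    (All.universal (λ _ → z≤n) _) (All.tail bounded) (suc-injective len)
    (λ a∈ → All.lookup (AllPairs.head unique) a∈ refl) z≤n (All.head bounded))

moveToFront-permutation : ∀ n {a} → a < n → IsPermutation n (moveToFront n a)
moveToFront-permutation n {a} a<n =
  trans (length-delete (∈-range 0 n z≤n a<n)) (length-range 0 n) ,
  a<n ∷ All-resp-⊆ (delete-⊆ a _) (range-upper 0 n) ,
  All.tabulate (λ x∈ a≡x → ∉-delete range-unique (subst (_∈ _) (sym a≡x) x∈)) ∷
  AllPairs-resp-⊆ (delete-⊆ a _) range-unique
  where
  range-unique : Unique (range 0 n)
  range-unique = AllPairs.map <⇒≢ (range-increasing 0 n)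

moveToFront-good : ∀ m {a} → a ∈ range 1 m → T (good (moveToFront (suc m) a))
moveToFront-good m {a} a∈ =
  from T-∧ (moveToFront-desarrangement ,
            all⁻ (avoids (moveToFront (suc m) a)) {p132 ∷ p321 ∷ []}
                 (avoidance 1 3 2 ≤-refl ∷ avoidance 3 2 1 ≤-refl ∷ []))
  where
  avoidance : ∀ p q r → r < q → T (avoids (moveToFront (suc m) a) (p ∷ q ∷ r ∷ []))
  avoidance _ _ _ = ∷-increasing⇒avoids (AllPairs-resp-⊆ (delete-⊆ a _) (range-increasing 0 (suc m)))
  moveToFront-desarrangement : T (desarrangement (moveToFront (suc m) a))
  moveToFront-desarrangement with 0 ≟ a
  ... | yes refl = contradiction (All.lookup (range-lower 1 m) a∈) λ ()
  ... | no _     = desarrangement-∷0 (delete a (range 1 m)) (All.lookup (range-lower 1 m) a∈)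

∈-good-perms⇔∈-moveToFront : ∀ m {w} →
  w ∈ filterᵇ good (perms (suc m)) ⇔ w ∈ map (moveToFront (suc m)) (range 1 m)
∈-good-perms⇔∈-moveToFront m = mk⇔
  (λ w∈ → let (w∈perms , t) = ∈-filter⁻ (T? ∘ good) w∈
              (a , a∈ , w≡) = good⇒moveToFront m (∈-perms⁻ (suc m) w∈perms) t
          in subst (_∈ _) (sym w≡) (∈-map⁺ _ a∈))
  (λ w∈ → let (a , a∈ , w≡) = ∈-map⁻ _ w∈
              permutation = moveToFront-permutation (suc m) (All.lookup (range-upper 1 m) a∈)
          in subst (_∈ _) (sym w≡) (∈-filter⁺ (T? ∘ good) (∈-perms⁺ (suc m) permutation) (moveToFront-good m a∈)))

good-perms↭moveToFront : ∀ m → filterᵇ good (perms (suc m)) ↭ map (moveToFront (suc m)) (range 1 m)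
good-perms↭moveToFront m =
  ∼bag⇒↭ (unique∧set⇒bag good-perms-unique moveToFront-unique (∈-good-perms⇔∈-moveToFront m))
  where
  good-perms-unique : Unique (filterᵇ good (perms (suc m)))
  good-perms-unique =
    Unique.filter⁺ (T? ∘ good) (Unique.filter⁺ (T? ∘ distinct) (words-unique (suc m) (suc m)))
  moveToFront-unique : Unique (map (moveToFront (suc m)) (range 1 m))
  moveToFront-unique = Unique.map⁺ ∷-injectiveˡ (AllPairs.map <⇒≢ (range-increasing 1 m))

theorem3p13 : (n : ℕ) → n ≥ 1 → d n ((1 ∷ 3 ∷ 2 ∷ []) ∷ (3 ∷ 2 ∷ 1 ∷ []) ∷ []) ≡ n ∸ 1
theorem3p13 (suc m) _ = begin
  length (filterᵇ good (perms (suc m)))          ≡⟨ ↭-length (good-perms↭moveToFront m) ⟩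
  length (map (moveToFront (suc m)) (range 1 m)) ≡⟨ length-map _ (range 1 m) ⟩
  length (range 1 m)                             ≡⟨ length-range 1 m ⟩
  m                                              ∎
  where open ≡-Reasoning
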